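{- Let $G$ be a finite simple graph on $n\ge 1$ vertices and set $k=\lfloor n/2\rfloor$. Then $\sigma_k(G)\le 2\sigma(G)$.
   Context: $N[v]$ denotes the closed neighborhood of $v$ ($v$ together with its neighbors) and $\deg(v)$ its degree. $\sigma_k(G)=\sum_{v\in V(G)}\binom{n-|N[v]|}{k}\big/\binom{n}{k}$, where $\binom{a}{k}=0$ when $k>a$, and $\sigma(G)=\sum_{v\in V(G)}2^{ -\deg(v)-1}$. -}

module Defs where

open import Data.Bool using (Bool; true; false; T)
open import Data.Nat as ℕ using (ℕ; zero; suc; _∸_; _^_)
open import Data.Nat.Combinatorics using (_C_)
open import Data.Fin using (Fin)
open import Data.List using (List; length; filterᵇ; map; foldr; allFin)
open import Data.Integer using (+_)
open import Data.Rational using (ℚ; 0ℚ; _+_; _/_)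
open import Relation.Binary.PropositionalEquality using (_≡_)
open import Relation.Nullary using (¬_)

record SimpleGraph (n : ℕ) : Set where
  field
    Adj   : Fin n → Fin n → Bool
    sym   : ∀ u v → Adj u v ≡ Adj v u
    loopless : ∀ v → Adj v v ≡ false
open SimpleGraph public

deg : ∀ {n} → SimpleGraph n → Fin n → ℕ
deg G v = length (filterᵇ (Adj G v) (allFin _))

-- |N[v]| = deg(v) + 1 (closed neighbourhood; v is not its own neighbour)
closedNbhdSize : ∀ {n} → SimpleGraph n → Fin n → ℕ
closedNbhdSize G v = suc (deg G v)

-- a / b as a rational number, for natural numbers a and b ≠ 0
-- (b = 0 never occurs below; it is mapped to 0 only to make the function total)
frac : ℕ → ℕ → ℚ
frac a zero    = 0ℚ
frac a (suc b) = (+ a) / suc b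

sumV : ∀ n → (Fin n → ℚ) → ℚ
sumV n f = foldr _+_ 0ℚ (map f (allFin n))

-- σ_k(G) = Σ_v C(n - |N[v]|, k) / C(n, k)    (C(a,k) = 0 when k > a)
σ[_] : ℕ → ∀ {n} → SimpleGraph n → ℚ
σ[ k ] {n} G = sumV n (λ v → frac ((n ∸ closedNbhdSize G v) C k) (n C k))

σ : ∀ {n} → SimpleGraph n → ℚ
σ {n} G = sumV n (λ v → frac 1 (2 ^ suc (deg G v)))

{-# OPTIONS --safe #-}
module Submission where

open import Defs
open import Data.Nat using (ℕ; _≥_; _/_)
open import Data.Rational using (_≤_; _*_; _+_; 1ℚ)

open import Data.Bool using (T)
open import Data.Fin using (Fin)
open import Data.Integer as ℤ using (+_)
import Data.Integer.Properties as ℤ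
open import Data.List using (List; []; _∷_; map; foldr; allFin)
open import Data.List.Properties using (filter-notAll; length-tabulate)
open import Data.List.Membership.Propositional.Properties using (∈-allFin)
import Data.List.Relation.Unary.Any as Any
open import Data.Nat as ℕ using (zero; suc; _∸_; _^_; _<_; z≤n; s≤s; s≤s⁻¹; NonZero; >-nonZero)
import Data.Nat.Properties as ℕ
open import Data.Nat.Combinatorics using (_C_; nC1≡n; nCk+nC[k+1]≡[n+1]C[k+1])
open import Data.Nat.DivMod using (_%_; m≡m%n+[m/n]*n; m%n<n; m/n≤m)
open import Data.Rational as ℚ using (ℚ; 0ℚ; toℚᵘ)
import Data.Rational.Properties as ℚ
open import Data.Rational.Unnormalised as ℚᵘ using (mkℚᵘ; *≤*)
import Data.Rational.Unnormalised.Properties as ℚᵘ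
open import Function using (_∘_)
open import Relation.Binary.PropositionalEquality as ≡ using (_≡_; refl; trans; cong; cong₂; subst; subst₂; module ≡-Reasoning)
open import Relation.Nullary using (¬_)
open import Relation.Nullary.Decidable using (T?)

-- For a vertex of degree d the claim reads 2^d · C(n-1-d, k) ≤ C(n, k).  Since n - 1 ≤ 2k, removing
-- one point from a ground set of size m ≤ 2k at least halves the number of k-subsets:
-- 2 · C(m-1, k) ≤ C(m, k), because C(m-1, k) ≤ C(m-1, k-1) as soon as m ≤ 2k.  Removing the d
-- neighbours one at a time from n - 1 points gives 2^d · C(n-1-d, k) ≤ C(n-1, k) ≤ C(n, k).

*-absorption-C : ∀ n k → suc k ℕ.* (suc n C suc k) ≡ suc n ℕ.* (n C k)
*-absorption-C n       zero    = trans (ℕ.*-identityˡ _) (trans (nC1≡n (suc n)) (≡.sym (ℕ.*-identityʳ _)))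
*-absorption-C zero    (suc k) = ℕ.*-zeroʳ (suc (suc k))
*-absorption-C (suc n) (suc k) = begin
  suc j ℕ.* (suc m C suc j)                 ≡⟨ cong (suc j ℕ.*_) (≡.sym (nCk+nC[k+1]≡[n+1]C[k+1] m j)) ⟩
  suc j ℕ.* (x ℕ.+ z)                       ≡⟨ ℕ.*-distribˡ-+ (suc j) x z ⟩
  (x ℕ.+ j ℕ.* x) ℕ.+ suc j ℕ.* z           ≡⟨ cong₂ (λ u w → (x ℕ.+ u) ℕ.+ w) (*-absorption-C n k) (*-absorption-C n j) ⟩
  (x ℕ.+ m ℕ.* (n C k)) ℕ.+ m ℕ.* (n C j)   ≡⟨ ℕ.+-assoc x _ _ ⟩
  x ℕ.+ (m ℕ.* (n C k) ℕ.+ m ℕ.* (n C j))   ≡⟨ cong (x ℕ.+_) (≡.sym (ℕ.*-distribˡ-+ m (n C k) (n C j))) ⟩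
  x ℕ.+ m ℕ.* (n C k ℕ.+ n C j)             ≡⟨ cong (λ y → x ℕ.+ m ℕ.* y) (nCk+nC[k+1]≡[n+1]C[k+1] n k) ⟩
  x ℕ.+ m ℕ.* x                             ∎
  where
  open ≡-Reasoning
  m = suc n
  j = suc k
  x = m C j
  z = m C suc j

nC[1+k]≤nCk : ∀ n k → n < suc k ℕ.+ suc k → n C suc k ℕ.≤ n C k
nC[1+k]≤nCk n k n<2[1+k] = ℕ.*-cancelˡ-≤ (suc k) (ℕ.+-cancelʳ-≤ (suc k ℕ.* (n C k)) _ _ (begin
  suc k ℕ.* (n C suc k) ℕ.+ suc k ℕ.* (n C k)  ≡⟨ ≡.sym (ℕ.*-distribˡ-+ (suc k) (n C suc k) (n C k)) ⟩
  suc k ℕ.* (n C suc k ℕ.+ n C k)              ≡⟨ cong (suc k ℕ.*_) (ℕ.+-comm (n C suc k) (n C k)) ⟩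
  suc k ℕ.* (n C k ℕ.+ n C suc k)              ≡⟨ cong (suc k ℕ.*_) (nCk+nC[k+1]≡[n+1]C[k+1] n k) ⟩
  suc k ℕ.* (suc n C suc k)                    ≡⟨ *-absorption-C n k ⟩
  suc n ℕ.* (n C k)                            ≤⟨ ℕ.*-monoˡ-≤ (n C k) n<2[1+k] ⟩
  (suc k ℕ.+ suc k) ℕ.* (n C k)                ≡⟨ ℕ.*-distribʳ-+ (n C k) (suc k) (suc k) ⟩
  suc k ℕ.* (n C k) ℕ.+ suc k ℕ.* (n C k)      ∎))
  where open ℕ.≤-Reasoning

nCk≤[1+n]Ck : ∀ n k → n C k ℕ.≤ suc n C k
nCk≤[1+n]Ck n zero    = ℕ.≤-refl
nCk≤[1+n]Ck n (suc k) = ℕ.≤-trans (ℕ.m≤n+m (n C suc k) (n C k))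
                                   (ℕ.≤-reflexive (nCk+nC[k+1]≡[n+1]C[k+1] n k))

k≤n⇒nCk>0 : ∀ {n k} → k ℕ.≤ n → n C k ℕ.> 0
k≤n⇒nCk>0 {n}     {zero}  _         = s≤s z≤n
k≤n⇒nCk>0 {suc n} {suc k} (s≤s k≤n) = ℕ.≤-trans (k≤n⇒nCk>0 k≤n) (ℕ.≤-trans (ℕ.m≤m+n (n C k) (n C suc k))
                                                  (ℕ.≤-reflexive (nCk+nC[k+1]≡[n+1]C[k+1] n k)))

2*nCk≤[1+n]Ck : ∀ n k → n < k ℕ.+ k → 2 ℕ.* (n C k) ℕ.≤ suc n C k
2*nCk≤[1+n]Ck n zero    ()
2*nCk≤[1+n]Ck n (suc k) n<2k = begin
  2 ℕ.* (n C suc k)        ≡⟨ cong (n C suc k ℕ.+_) (ℕ.+-identityʳ (n C suc k)) ⟩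
  n C suc k ℕ.+ n C suc k  ≤⟨ ℕ.+-monoˡ-≤ (n C suc k) (nC[1+k]≤nCk n k n<2k) ⟩
  n C k ℕ.+ n C suc k      ≡⟨ nCk+nC[k+1]≡[n+1]C[k+1] n k ⟩
  suc n C suc k            ∎
  where open ℕ.≤-Reasoning

2^d*[n∸d]Ck≤nCk : ∀ k n d → n ℕ.≤ k ℕ.+ k → d ℕ.≤ n → 2 ^ d ℕ.* ((n ∸ d) C k) ℕ.≤ n C k
2^d*[n∸d]Ck≤nCk k n       zero    _      _         = ℕ.≤-reflexive (ℕ.*-identityˡ (n C k))
2^d*[n∸d]Ck≤nCk k (suc n) (suc d) 1+n≤2k (s≤s d≤n) = begin
  (2 ℕ.* 2 ^ d) ℕ.* ((n ∸ d) C k)   ≡⟨ ℕ.*-assoc 2 (2 ^ d) ((n ∸ d) C k) ⟩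
  2 ℕ.* (2 ^ d ℕ.* ((n ∸ d) C k))   ≤⟨ ℕ.*-monoʳ-≤ 2 (2^d*[n∸d]Ck≤nCk k n d (ℕ.<⇒≤ 1+n≤2k) d≤n) ⟩
  2 ℕ.* (n C k)                     ≤⟨ 2*nCk≤[1+n]Ck n k 1+n≤2k ⟩
  suc n C k                         ∎
  where open ℕ.≤-Reasoning

n≤[1+n]/2+[1+n]/2 : ∀ n → n ℕ.≤ suc n / 2 ℕ.+ suc n / 2
n≤[1+n]/2+[1+n]/2 n = s≤s⁻¹ (begin
  suc n                        ≡⟨ m≡m%n+[m/n]*n (suc n) 2 ⟩
  suc n % 2 ℕ.+ k ℕ.* 2        ≤⟨ ℕ.+-monoˡ-≤ (k ℕ.* 2) (s≤s⁻¹ (m%n<n (suc n) 2)) ⟩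
  suc (k ℕ.* 2)                ≡⟨ cong suc (ℕ.*-comm k 2) ⟩
  suc (k ℕ.+ (k ℕ.+ 0))        ≡⟨ cong (λ m → suc (k ℕ.+ m)) (ℕ.+-identityʳ k) ⟩
  suc (k ℕ.+ k)                ∎)
  where
  open ℕ.≤-Reasoning
  k = suc n / 2

deg<n : ∀ {n} (G : SimpleGraph n) v → deg G v < n
deg<n {n} G v = subst (deg G v <_) (length-tabulate {n = n} (λ u → u))
  (filter-notAll (T? ∘ Adj G v) (allFin n) (Any.map (λ { refl → not-self-adjacent }) (∈-allFin v)))
  where
  not-self-adjacent : ¬ T (Adj G v v)
  not-self-adjacent = subst T (loopless G v)

[n∸d]Ck*2^[1+d]≤2*[1+n]Ck : ∀ n d → d ℕ.≤ n →
  ((n ∸ d) C (suc n / 2)) ℕ.* 2 ^ suc d ℕ.≤ 2 ℕ.* (suc n C (suc n / 2))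
[n∸d]Ck*2^[1+d]≤2*[1+n]Ck n d d≤n = begin
  ((n ∸ d) C k) ℕ.* (2 ℕ.* 2 ^ d)   ≡⟨ ℕ.*-comm ((n ∸ d) C k) (2 ℕ.* 2 ^ d) ⟩
  (2 ℕ.* 2 ^ d) ℕ.* ((n ∸ d) C k)   ≡⟨ ℕ.*-assoc 2 (2 ^ d) ((n ∸ d) C k) ⟩
  2 ℕ.* (2 ^ d ℕ.* ((n ∸ d) C k))   ≤⟨ ℕ.*-monoʳ-≤ 2 (2^d*[n∸d]Ck≤nCk k n d (n≤[1+n]/2+[1+n]/2 n) d≤n) ⟩
  2 ℕ.* (n C k)                     ≤⟨ ℕ.*-monoʳ-≤ 2 (nCk≤[1+n]Ck n k) ⟩
  2 ℕ.* (suc n C k)                 ∎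
  where
  open ℕ.≤-Reasoning
  k = suc n / 2

toℚᵘ-frac : ∀ a b → toℚᵘ (frac a (suc b)) ℚᵘ.≃ mkℚᵘ (+ a) b
toℚᵘ-frac a b = ℚ.toℚᵘ-fromℚᵘ (mkℚᵘ (+ a) b)

frac-≤ : ∀ a b c e .{{_ : NonZero b}} .{{_ : NonZero e}} → a ℕ.* e ℕ.≤ c ℕ.* b → frac a b ≤ frac c e
frac-≤ a (suc b) c (suc e) ae≤cb = ℚ.toℚᵘ-cancel-≤ (begin
  toℚᵘ (frac a (suc b))  ≃⟨ toℚᵘ-frac a b ⟩
  mkℚᵘ (+ a) b           ≤⟨ *≤* (subst₂ ℤ._≤_ (ℤ.pos-* a (suc e)) (ℤ.pos-* c (suc b)) (ℤ.+≤+ ae≤cb)) ⟩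
  mkℚᵘ (+ c) e           ≃⟨ toℚᵘ-frac c e ⟨
  toℚᵘ (frac c (suc e))  ∎)
  where open ℚᵘ.≤-Reasoning

frac-* : ∀ a b c e .{{_ : NonZero b}} .{{_ : NonZero e}} → frac a b * frac c e ≡ frac (a ℕ.* c) (b ℕ.* e)
frac-* a (suc b) c (suc e) = ℚ.toℚᵘ-injective (begin
  toℚᵘ (frac a (suc b) * frac c (suc e))           ≈⟨ ℚ.toℚᵘ-homo-* (frac a (suc b)) (frac c (suc e)) ⟩
  toℚᵘ (frac a (suc b)) ℚᵘ.* toℚᵘ (frac c (suc e)) ≈⟨ ℚᵘ.*-cong (toℚᵘ-frac a b) (toℚᵘ-frac c e) ⟩
  mkℚᵘ (+ a ℤ.* + c) (e ℕ.+ b ℕ.* suc e)           ≡⟨ cong (λ i → mkℚᵘ i (e ℕ.+ b ℕ.* suc e)) (ℤ.pos-* a c) ⟨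
  mkℚᵘ (+ (a ℕ.* c)) (e ℕ.+ b ℕ.* suc e)           ≈⟨ toℚᵘ-frac (a ℕ.* c) (e ℕ.+ b ℕ.* suc e) ⟨
  toℚᵘ (frac (a ℕ.* c) (suc b ℕ.* suc e))          ∎)
  where open ℚᵘ.≃-Reasoning

∑ : ∀ {A : Set} → List A → (A → ℚ) → ℚ
∑ xs f = foldr _+_ 0ℚ (map f xs)

∑-mono-≤ : ∀ {A : Set} (xs : List A) {f g : A → ℚ} → (∀ x → f x ≤ g x) → ∑ xs f ≤ ∑ xs g
∑-mono-≤ []       _   = ℚ.≤-refl
∑-mono-≤ (x ∷ xs) f≤g = ℚ.+-mono-≤ (f≤g x) (∑-mono-≤ xs f≤g)

∑-*ˡ : ∀ {A : Set} (xs : List A) c (f : A → ℚ) → ∑ xs (λ x → c * f x) ≡ c * ∑ xs f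
∑-*ˡ []       c f = ≡.sym (ℚ.*-zeroʳ c)
∑-*ˡ (x ∷ xs) c f = trans (cong (_+_ (c * f x)) (∑-*ˡ xs c f)) (≡.sym (ℚ.*-distribˡ-+ c (f x) (∑ xs f)))

σ[k]-term≤2*σ-term : ∀ {n} (G : SimpleGraph (suc n)) v →
  frac ((suc n ∸ closedNbhdSize G v) C (suc n / 2)) (suc n C (suc n / 2)) ≤ (1ℚ + 1ℚ) * frac 1 (2 ^ suc (deg G v))
σ[k]-term≤2*σ-term {n} G v = begin
  frac ((n ∸ d) C k) (suc n C k)     ≤⟨ frac-≤ ((n ∸ d) C k) (suc n C k) 2 (2 ^ suc d)
                                          ([n∸d]Ck*2^[1+d]≤2*[1+n]Ck n d (s≤s⁻¹ (deg<n G v))) ⟩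
  frac 2 (2 ^ suc d)                 ≡⟨ cong (frac 2) (ℕ.*-identityˡ (2 ^ suc d)) ⟨
  frac (2 ℕ.* 1) (1 ℕ.* 2 ^ suc d)   ≡⟨ frac-* 2 1 1 (2 ^ suc d) ⟨
  frac 2 1 * frac 1 (2 ^ suc d)      ≡⟨⟩
  (1ℚ + 1ℚ) * frac 1 (2 ^ suc d)     ∎
  where
  open ℚ.≤-Reasoning
  d = deg G v
  k = suc n / 2
  instance
    C-nonZero : NonZero (suc n C k)
    C-nonZero = >-nonZero (k≤n⇒nCk>0 (m/n≤m (suc n) 2))
    2^-nonZero : NonZero (2 ^ suc d)
    2^-nonZero = ℕ.m^n≢0 2 (suc d)

proposition10 : (n : ℕ) → n ≥ 1 → (G : SimpleGraph n) →
    σ[ n / 2 ] G ≤ (1ℚ + 1ℚ) * σ G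
proposition10 (suc n) _ G = begin
  σ[ suc n / 2 ] G                          ≤⟨ ∑-mono-≤ (allFin (suc n)) (σ[k]-term≤2*σ-term G) ⟩
  ∑ (allFin (suc n)) (λ v → 2ℚ * σ-term v)  ≡⟨ ∑-*ˡ (allFin (suc n)) 2ℚ σ-term ⟩
  2ℚ * σ G                                  ∎
  where
  open ℚ.≤-Reasoning
  2ℚ : ℚ
  2ℚ = 1ℚ + 1ℚ
  σ-term : Fin (suc n) → ℚ
  σ-term v = frac 1 (2 ^ suc (deg G v))
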